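{- Let $G$ be a nontrivial, connected graph. If $G \times K_3$ is well-covered, then $G=K_3$ or $G$ has at least one isolatable vertex.
   Context: Graphs are finite and simple; nontrivial means having at least two vertices. The direct product $G\times H$ has vertex set $V(G)\times V(H)$, with $(g_1,h_1)(g_2,h_2)$ an edge iff $g_1g_2\in E(G)$ and $h_1h_2\in E(H)$. A graph is well-covered if all of its maximal independent sets have the same cardinality. A vertex $x$ of $G$ is isolatable if there exists an independent set $I$ of $G$ such that $x$ is an isolated vertex of $G-N[I]$ ($I$ may be empty). -}

module Defs where

open import Data.Nat using (ℕ; _≤_)
open import Data.Fin using (Fin; zero; suc; remQuot)
open import Data.Fin.Subset using (Subset; _∈_; _∉_; _⊆_; ∣_∣)
open import Data.Bool using (Bool; true; false; _∧_; not)
open import Data.Product using (Σ; _×_; _,_; proj₁; proj₂; ∃; ∃-syntax)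
open import Data.Sum using (_⊎_)
import Data.Empty
import Data.Nat
open import Relation.Binary.PropositionalEquality using (_≡_)
open import Function.Bundles using (_↔_; Inverse)

record Graph (n : ℕ) : Set where
  field
    adj   : Fin n → Fin n → Bool
    sym   : ∀ u v → adj u v ≡ adj v u
    irrefl : ∀ v → adj v v ≡ false
open Graph public

Nontrivial : ∀ {n} → Graph n → Set
Nontrivial {n} _ = 2 ≤ n

data Reachable {n} (G : Graph n) : Fin n → Fin n → Set where
  here : ∀ {v} → Reachable G v v
  step : ∀ {u v w} → adj G u v ≡ true → Reachable G v w → Reachable G u w

Connected : ∀ {n} → Graph n → Set
Connected {n} G = ∀ (u v : Fin n) → Reachable G u v

K : (m : ℕ) → Graph m
K m = record { adj = λ u v → not (eqb u v) ; sym = symK ; irrefl = irrK }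
  where
  eqb : ∀ {k} → Fin k → Fin k → Bool
  eqb zero zero = true
  eqb zero (suc _) = false
  eqb (suc _) zero = false
  eqb (suc a) (suc b) = eqb a b
  eqbsym : ∀ {k} (a b : Fin k) → eqb a b ≡ eqb b a
  eqbsym zero zero = _≡_.refl
  eqbsym zero (suc _) = _≡_.refl
  eqbsym (suc _) zero = _≡_.refl
  eqbsym (suc a) (suc b) = eqbsym a b
  eqbrefl : ∀ {k} (a : Fin k) → eqb a a ≡ true
  eqbrefl zero = _≡_.refl
  eqbrefl (suc a) = eqbrefl a
  symK : ∀ u v → not (eqb u v) ≡ not (eqb v u)
  symK u v rewrite eqbsym u v = _≡_.refl
  irrK : ∀ v → not (eqb v v) ≡ false
  irrK v rewrite eqbrefl v = _≡_.refl

-- Direct (tensor/categorical) product G × H on Fin (n * m), where the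
-- vertex i corresponds to the pair remQuot m i = (g , h).
_×ᵍ_ : ∀ {n m} → Graph n → Graph m → Graph (n Data.Nat.* m)
_×ᵍ_ {n} {m} G H = record { adj = a ; sym = s ; irrefl = ir }
  where
  rq : Fin (n Data.Nat.* m) → Fin n × Fin m
  rq = remQuot {n} m
  a : Fin (n Data.Nat.* m) → Fin (n Data.Nat.* m) → Bool
  a i j = adj G (proj₁ (rq i)) (proj₁ (rq j)) ∧ adj H (proj₂ (rq i)) (proj₂ (rq j))
  s : ∀ i j → a i j ≡ a j i
  s i j rewrite sym G (proj₁ (rq i)) (proj₁ (rq j))
              | sym H (proj₂ (rq i)) (proj₂ (rq j)) = _≡_.refl
  ir : ∀ i → a i i ≡ false
  ir i rewrite irrefl G (proj₁ (rq i)) = _≡_.refl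

_≅_ : ∀ {n m} → Graph n → Graph m → Set
_≅_ {n} {m} G H = Σ (Fin n ↔ Fin m) λ f →
  ∀ u v → adj H (Inverse.to f u) (Inverse.to f v) ≡ adj G u v

Independent : ∀ {n} → Graph n → Subset n → Set
Independent G S = ∀ u v → u ∈ S → v ∈ S → adj G u v ≡ false

MaximalIndependent : ∀ {n} → Graph n → Subset n → Set
MaximalIndependent {n} G S =
  Independent G S × (∀ (T : Subset n) → Independent G T → S ⊆ T → T ⊆ S)

WellCovered : ∀ {n} → Graph n → Set
WellCovered {n} G = ∀ (S T : Subset n) →
  MaximalIndependent G S → MaximalIndependent G T → ∣ S ∣ ≡ ∣ T ∣

InClosedNbhd : ∀ {n} → Graph n → Subset n → Fin n → Set
InClosedNbhd G I v = v ∈ I ⊎ (∃[ u ] (u ∈ I × adj G u v ≡ true))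

Isolatable : ∀ {n} → Graph n → Fin n → Set
Isolatable {n} G x = ∃[ I ] (Independent G I
  × (InClosedNbhd G I x → Data.Empty.⊥)
  × (∀ (y : Fin n) → (InClosedNbhd G I y → Data.Empty.⊥) → adj G x y ≡ false))

module Submission where

-- For an independent set I of G put S(I) = (I × V(K₃)) ∪ ((V(G) ∖ N[I]) × {0}). It is independent in
-- G × K₃, and it is maximal as soon as G − N[I] has no isolated vertex, which holds for every I when no
-- vertex of G is isolatable. As |S(I)| + |N[I]| = 3|I| + n and S(∅) has n vertices, well-coveredness
-- then forces |N[I]| = 3|I| for every independent I. For I = {v} this says that every vertex has
-- exactly two neighbours; for I = {y, z} with y, z non-adjacent neighbours of a common vertex x it
-- fails, since N[I] = N[y] ∪ N[z] has at most 3 + 3 − 1 elements as x ∈ N[y] ∩ N[z]. So the two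
-- neighbours of any vertex are adjacent, that triangle is closed under adjacency, and connectedness
-- makes G the triangle.

open import Data.Bool using (Bool; true; false; _∧_)
import Data.Bool as Bool
open import Data.Bool.Properties using (¬-not; ∧-zeroʳ)
open import Data.Fin using (Fin; zero; suc; _≟_; remQuot; combine)
open import Data.Fin.Patterns using (0F; 1F; 2F)
open import Data.Fin.Properties using (remQuot-combine; combine-remQuot; any?; all?)
open import Data.Fin.Subset using (Subset; _∈_; _∉_; _⊆_; ∣_∣; ⊥; ⁅_⁆; _∪_; _∩_; ∁; _-_; _─_; inside; outside)
open import Data.Fin.Subset.Properties
  using ( _∈?_; nonempty?; anySubset?; Empty-unique; ∉⊥; ∣⊥∣≡0; ∣p∣≤n; ∣∁p∣≡n∸∣p∣; ∣⁅x⁆∣≡1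
        ; x∈⁅x⁆; x∈⁅y⁆⇒x≡y; x∉⁅y⁆⇒x≢y; x≢y⇒x∉⁅y⁆; ⊆-antisym
        ; p⊆p∪q; q⊆p∪q; x∈p∪q⁺; x∈p∪q⁻; x∈p∩q⁺; x∈p∩q⁻; x∉p⇒x∈∁p; x∈∁p⇒x∉p; x∈p⇒x∉∁p
        ; p─⊥≡p; p─q⊆p; x∈p∧x≢y⇒x∈p-y )
open import Data.Nat using (ℕ; zero; suc; _+_; _*_)
open import Data.Nat.Properties
  using (+-suc; +-identityʳ; +-comm; +-cancelˡ-≡; suc-injective; 0≢1+n; m≢1+m+n; m∸n+n≡m)
open import Data.Nat.Tactic.RingSolver using (solve-∀)
open import Data.Product using (_×_; _,_; ∃-syntax; ∃₂; proj₁; proj₂; uncurry)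
open import Data.Sum using (_⊎_; inj₁; inj₂)
import Data.Sum as Sum
open import Data.Vec using (_∷_; []; here; there; tabulate; lookup)
open import Data.Vec.Properties using (lookup∘tabulate; tabulate∘lookup; []=⇒lookup; lookup⇒[]=)
open import Function using (_∘_; id; flip)
open import Function.Bundles using (mk↔ₛ′)
open import Relation.Binary.PropositionalEquality
open import Relation.Nullary using (¬_; yes; no; does; contradiction; _⊎-dec_; _×-dec_; _→-dec_; ¬?)
open import Relation.Nullary.Decidable using (dec-true)
open import Relation.Unary using (Pred; Decidable)

open import Defs renaming (sym to adj-sym)

private variable
  n : ℕ
  p q : Subset n
  x y z w : Fin n

∣p∪q∣+∣p∩q∣≡∣p∣+∣q∣ : ∀ (p q : Subset n) → ∣ p ∪ q ∣ + ∣ p ∩ q ∣ ≡ ∣ p ∣ + ∣ q ∣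
∣p∪q∣+∣p∩q∣≡∣p∣+∣q∣ [] [] = refl
∣p∪q∣+∣p∩q∣≡∣p∣+∣q∣ (outside ∷ p) (outside ∷ q) = ∣p∪q∣+∣p∩q∣≡∣p∣+∣q∣ p q
∣p∪q∣+∣p∩q∣≡∣p∣+∣q∣ (outside ∷ p) (inside ∷ q) =
  trans (cong suc (∣p∪q∣+∣p∩q∣≡∣p∣+∣q∣ p q)) (sym (+-suc ∣ p ∣ ∣ q ∣))
∣p∪q∣+∣p∩q∣≡∣p∣+∣q∣ (inside ∷ p) (outside ∷ q) = cong suc (∣p∪q∣+∣p∩q∣≡∣p∣+∣q∣ p q)
∣p∪q∣+∣p∩q∣≡∣p∣+∣q∣ (inside ∷ p) (inside ∷ q) = cong suc (begin
  ∣ p ∪ q ∣ + suc ∣ p ∩ q ∣   ≡⟨ +-suc ∣ p ∪ q ∣ ∣ p ∩ q ∣ ⟩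
  suc (∣ p ∪ q ∣ + ∣ p ∩ q ∣) ≡⟨ cong suc (∣p∪q∣+∣p∩q∣≡∣p∣+∣q∣ p q) ⟩
  suc (∣ p ∣ + ∣ q ∣)         ≡⟨ +-suc ∣ p ∣ ∣ q ∣ ⟨
  ∣ p ∣ + suc ∣ q ∣           ∎)
  where open ≡-Reasoning

x∈p⇒∣p∣≡1+∣p-x∣ : x ∈ p → ∣ p ∣ ≡ suc ∣ p - x ∣
x∈p⇒∣p∣≡1+∣p-x∣ {p = inside ∷ p} here = cong suc (cong ∣_∣ (sym (p─⊥≡p p)))
x∈p⇒∣p∣≡1+∣p-x∣ {p = inside ∷ p} (there x∈p) = cong suc (x∈p⇒∣p∣≡1+∣p-x∣ x∈p)
x∈p⇒∣p∣≡1+∣p-x∣ {p = outside ∷ p} (there x∈p) = x∈p⇒∣p∣≡1+∣p-x∣ x∈p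

∣p∪q∣≡∣p∣+∣q∣ : (∀ {x} → x ∈ p → x ∉ q) → ∣ p ∪ q ∣ ≡ ∣ p ∣ + ∣ q ∣
∣p∪q∣≡∣p∣+∣q∣ {n} {p} {q} disjoint = begin
  ∣ p ∪ q ∣                 ≡⟨ +-identityʳ _ ⟨
  ∣ p ∪ q ∣ + 0             ≡⟨ cong (∣ p ∪ q ∣ +_) ∣p∩q∣≡0 ⟨
  ∣ p ∪ q ∣ + ∣ p ∩ q ∣     ≡⟨ ∣p∪q∣+∣p∩q∣≡∣p∣+∣q∣ p q ⟩
  ∣ p ∣ + ∣ q ∣             ∎
  where
  open ≡-Reasoning
  ∣p∩q∣≡0 : ∣ p ∩ q ∣ ≡ 0
  ∣p∩q∣≡0 = trans (cong ∣_∣ (Empty-unique λ (_ , x∈p∩q) → uncurry disjoint (x∈p∩q⁻ p q x∈p∩q))) (∣⊥∣≡0 n)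

x∈p─q⇒x∉q : x ∈ p ─ q → x ∉ q
x∈p─q⇒x∉q {p = _ ∷ p} {q = outside ∷ q} here = λ ()
x∈p─q⇒x∉q {p = _ ∷ p} {q = inside ∷ q} (there x∈p─q) (there x∈q) = x∈p─q⇒x∉q x∈p─q x∈q
x∈p─q⇒x∉q {p = _ ∷ p} {q = outside ∷ q} (there x∈p─q) (there x∈q) = x∈p─q⇒x∉q x∈p─q x∈q

x∈p-y⇒x≢y : x ∈ p - y → x ≢ y
x∈p-y⇒x≢y x∈p-y = x∉⁅y⁆⇒x≢y (x∈p─q⇒x∉q x∈p-y)

pick : ∀ {k} → ∣ p ∣ ≡ suc k → ∃[ x ] (x ∈ p × ∣ p - x ∣ ≡ k)
pick {n} {p} ∣p∣≡1+k with nonempty? p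
... | yes (x , x∈p) = x , x∈p , suc-injective (trans (sym (x∈p⇒∣p∣≡1+∣p-x∣ x∈p)) ∣p∣≡1+k)
... | no p≡∅ = contradiction (trans (sym (cong ∣_∣ (Empty-unique p≡∅))) ∣p∣≡1+k) (0≢1+n ∘ trans (sym (∣⊥∣≡0 n)))

∣p∣≡3⇒two-others : ∣ p ∣ ≡ 3 → x ∈ p →
  ∃₂ λ y z → y ∈ p × z ∈ p × y ≢ x × z ≢ x × y ≢ z
∣p∣≡3⇒two-others {p = p} {x} ∣p∣≡3 x∈p
  with pick {p = p - x} (suc-injective (trans (sym (x∈p⇒∣p∣≡1+∣p-x∣ x∈p)) ∣p∣≡3))
... | y , y∈p-x , ∣p-x-y∣≡1 with pick {p = p - x - y} ∣p-x-y∣≡1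
...   | z , z∈p-x-y , _ =
  y , z , p─q⊆p p _ y∈p-x , p─q⊆p p _ (p─q⊆p (p - x) _ z∈p-x-y) ,
  x∈p-y⇒x≢y y∈p-x , x∈p-y⇒x≢y (p─q⊆p (p - x) _ z∈p-x-y) , x∈p-y⇒x≢y z∈p-x-y ∘ sym

∣p∣≡3⇒∈-three : ∣ p ∣ ≡ 3 → x ∈ p → y ∈ p → z ∈ p → x ≢ y → x ≢ z → y ≢ z →
  w ∈ p → w ≡ x ⊎ w ≡ y ⊎ w ≡ z
∣p∣≡3⇒∈-three {p = p} {x} {y} {z} {w} ∣p∣≡3 x∈p y∈p z∈p x≢y x≢z y≢z w∈p
  with w ≟ x | w ≟ y | w ≟ z
... | yes w≡x | _ | _ = inj₁ w≡x
... | no _ | yes w≡y | _ = inj₂ (inj₁ w≡y)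
... | no _ | no _ | yes w≡z = inj₂ (inj₂ w≡z)
... | no w≢x | no w≢y | no w≢z = contradiction ∣p∣≡4+k (m≢1+m+n 3 ∘ trans (sym ∣p∣≡3))
  where
  y∈p-x = x∈p∧x≢y⇒x∈p-y y∈p (x≢y ∘ sym)
  z∈p-x-y = x∈p∧x≢y⇒x∈p-y (x∈p∧x≢y⇒x∈p-y z∈p (x≢z ∘ sym)) (y≢z ∘ sym)
  w∈p-x-y-z = x∈p∧x≢y⇒x∈p-y (x∈p∧x≢y⇒x∈p-y (x∈p∧x≢y⇒x∈p-y w∈p w≢x) w≢y) w≢z
  ∣p∣≡4+k : ∣ p ∣ ≡ 4 + ∣ p - x - y - z - w ∣
  ∣p∣≡4+k = begin
    ∣ p ∣                 ≡⟨ x∈p⇒∣p∣≡1+∣p-x∣ x∈p ⟩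
    1 + ∣ p - x ∣         ≡⟨ cong suc (x∈p⇒∣p∣≡1+∣p-x∣ y∈p-x) ⟩
    2 + ∣ p - x - y ∣     ≡⟨ cong (2 +_) (x∈p⇒∣p∣≡1+∣p-x∣ z∈p-x-y) ⟩
    3 + ∣ p - x - y - z ∣ ≡⟨ cong (3 +_) (x∈p⇒∣p∣≡1+∣p-x∣ w∈p-x-y-z) ⟩
    4 + ∣ p - x - y - z - w ∣ ∎
    where open ≡-Reasoning

∈-tabulate⁺ : ∀ {f : Fin n → Bool} → f x ≡ true → x ∈ tabulate f
∈-tabulate⁺ {x = x} {f} fx≡true = lookup⇒[]= x (tabulate f) (trans (lookup∘tabulate f x) fx≡true)

∈-tabulate⁻ : ∀ {f : Fin n → Bool} → x ∈ tabulate f → f x ≡ true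
∈-tabulate⁻ {x = x} {f} x∈f = trans (sym (lookup∘tabulate f x)) ([]=⇒lookup x∈f)

subsetOf : ∀ {ℓ} {P : Pred (Fin n) ℓ} → Decidable P → Subset n
subsetOf P? = tabulate (does ∘ P?)

∈-subsetOf⁺ : ∀ {ℓ} {P : Pred (Fin n) ℓ} (P? : Decidable P) → P x → x ∈ subsetOf P?
∈-subsetOf⁺ {x = x} P? Px = ∈-tabulate⁺ (dec-true (P? x) Px)

∈-subsetOf⁻ : ∀ {ℓ} {P : Pred (Fin n) ℓ} (P? : Decidable P) → x ∈ subsetOf P? → P x
∈-subsetOf⁻ {x = x} P? x∈P with P? x | ∈-tabulate⁻ {f = does ∘ P?} x∈P
... | yes Px | _ = Px
... | no _ | ()

∣s∷p∣≡∣s∷[]∣+∣p∣ : ∀ s (p : Subset n) → ∣ s ∷ p ∣ ≡ ∣ s ∷ [] ∣ + ∣ p ∣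
∣s∷p∣≡∣s∷[]∣+∣p∣ outside p = refl
∣s∷p∣≡∣s∷[]∣+∣p∣ inside p = refl

∣tabulate∘remQuot∣ : ∀ (P : Fin n × Fin 3 → Bool) →
  ∣ tabulate (P ∘ remQuot 3) ∣ ≡
    ∣ tabulate (P ∘ (_, 0F)) ∣ + ∣ tabulate (P ∘ (_, 1F)) ∣ + ∣ tabulate (P ∘ (_, 2F)) ∣
∣tabulate∘remQuot∣ {zero} P = refl
∣tabulate∘remQuot∣ {suc n} P = begin
  ∣ a ∷ b ∷ c ∷ T ∣               ≡⟨ ∣s∷p∣≡∣s∷[]∣+∣p∣ a (b ∷ c ∷ T) ⟩
  α + ∣ b ∷ c ∷ T ∣               ≡⟨ cong (α +_) (∣s∷p∣≡∣s∷[]∣+∣p∣ b (c ∷ T)) ⟩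
  α + (β + ∣ c ∷ T ∣)             ≡⟨ cong (λ k → α + (β + k)) (∣s∷p∣≡∣s∷[]∣+∣p∣ c T) ⟩
  α + (β + (γ + ∣ T ∣))           ≡⟨ cong (λ k → α + (β + (γ + k))) (∣tabulate∘remQuot∣ P′) ⟩
  α + (β + (γ + (∣ T₀ ∣ + ∣ T₁ ∣ + ∣ T₂ ∣)))   ≡⟨ interchange α β γ (∣ T₀ ∣) (∣ T₁ ∣) (∣ T₂ ∣) ⟩
  (α + ∣ T₀ ∣) + (β + ∣ T₁ ∣) + (γ + ∣ T₂ ∣)   ≡⟨ cong₂ _+_ (cong₂ _+_ (∣s∷p∣≡∣s∷[]∣+∣p∣ a T₀) (∣s∷p∣≡∣s∷[]∣+∣p∣ b T₁)) (∣s∷p∣≡∣s∷[]∣+∣p∣ c T₂) ⟨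
  ∣ a ∷ T₀ ∣ + ∣ b ∷ T₁ ∣ + ∣ c ∷ T₂ ∣ ∎
  where
  open ≡-Reasoning
  a = P (zero , 0F)
  b = P (zero , 1F)
  c = P (zero , 2F)
  α = ∣ a ∷ [] ∣
  β = ∣ b ∷ [] ∣
  γ = ∣ c ∷ [] ∣
  P′ : Fin n × Fin 3 → Bool
  P′ (g , c) = P (suc g , c)
  T = tabulate (P′ ∘ remQuot 3)
  T₀ = tabulate (P′ ∘ (_, 0F))
  T₁ = tabulate (P′ ∘ (_, 1F))
  T₂ = tabulate (P′ ∘ (_, 2F))
  interchange : ∀ a b c A B C → a + (b + (c + (A + B + C))) ≡ (a + A) + (b + B) + (c + C)
  interchange = solve-∀

stack : ∀ {m} → (Fin m → Subset n) → Subset (n * m)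
stack {n} {m} F = tabulate (fibres ∘ remQuot {n} m)
  where fibres = λ ((g , c) : Fin n × Fin m) → lookup (F c) g

∈-stack⁺ : ∀ {m} (F : Fin m → Subset n) {g c} → g ∈ F c → combine g c ∈ stack F
∈-stack⁺ {n} {m} F {g} {c} g∈Fc = ∈-tabulate⁺
  (subst (λ (g′ , c′) → lookup (F c′) g′ ≡ true) (sym (remQuot-combine g c)) ([]=⇒lookup g∈Fc))

∈-stack⁻ : ∀ {m} (F : Fin m → Subset n) i → i ∈ stack F →
  let (g , c) = remQuot {n} m i in g ∈ F c
∈-stack⁻ {n} {m} F i i∈ = lookup⇒[]= _ (F _) (∈-tabulate⁻ i∈)

∣stack∣ : ∀ (F : Fin 3 → Subset n) → ∣ stack F ∣ ≡ ∣ F 0F ∣ + ∣ F 1F ∣ + ∣ F 2F ∣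
∣stack∣ F = trans (∣tabulate∘remQuot∣ (λ (g , c) → lookup (F c) g))
  (cong₂ _+_ (cong₂ _+_ (∣tabulate∘lookup∣ 0F) (∣tabulate∘lookup∣ 1F)) (∣tabulate∘lookup∣ 2F))
  where
  ∣tabulate∘lookup∣ : ∀ c → ∣ tabulate (lookup (F c)) ∣ ≡ ∣ F c ∣
  ∣tabulate∘lookup∣ c = cong ∣_∣ (tabulate∘lookup (F c))

∣∁p∣+∣p∣≡n : ∀ (p : Subset n) → ∣ ∁ p ∣ + ∣ p ∣ ≡ n
∣∁p∣+∣p∣≡n p = trans (cong (_+ ∣ p ∣) (∣∁p∣≡n∸∣p∣ p)) (m∸n+n≡m (∣p∣≤n p))

other : Fin 3 → Fin 3
other 0F = 1F
other (suc _) = 0F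

adj-other : ∀ c → adj (K 3) (other c) c ≡ true
adj-other 0F = refl
adj-other 1F = refl
adj-other 2F = refl

adjacent⇒≢ : ∀ (G : Graph n) {u v} → adj G u v ≡ true → u ≢ v
adjacent⇒≢ G {u} uv refl = contradiction (trans (sym uv) (irrefl G u)) λ ()

⁅x⁆-independent : ∀ (G : Graph n) x → Independent G ⁅ x ⁆
⁅x⁆-independent G x u v u∈⁅x⁆ v∈⁅x⁆
  rewrite x∈⁅y⁆⇒x≡y x u∈⁅x⁆ | x∈⁅y⁆⇒x≡y x v∈⁅x⁆ = irrefl G x

⁅x⁆∪⁅y⁆-independent : ∀ (G : Graph n) {x y} → adj G x y ≡ false → Independent G (⁅ x ⁆ ∪ ⁅ y ⁆)
⁅x⁆∪⁅y⁆-independent G {x} {y} xy u v u∈ v∈ = ¬adj (x∈p∪q⁻ _ _ u∈) (x∈p∪q⁻ _ _ v∈)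
  where
  ¬adj : ∀ {u v} → u ∈ ⁅ x ⁆ ⊎ u ∈ ⁅ y ⁆ → v ∈ ⁅ x ⁆ ⊎ v ∈ ⁅ y ⁆ → adj G u v ≡ false
  ¬adj (inj₁ u∈) (inj₁ v∈) = ⁅x⁆-independent G x _ _ u∈ v∈
  ¬adj (inj₂ u∈) (inj₂ v∈) = ⁅x⁆-independent G y _ _ u∈ v∈
  ¬adj (inj₁ u∈) (inj₂ v∈) rewrite x∈⁅y⁆⇒x≡y x u∈ | x∈⁅y⁆⇒x≡y y v∈ = xy
  ¬adj (inj₂ u∈) (inj₁ v∈) rewrite x∈⁅y⁆⇒x≡y y u∈ | x∈⁅y⁆⇒x≡y x v∈ = trans (adj-sym G y x) xy

adj-combine : ∀ {m} (G : Graph n) (H : Graph m) g g′ c c′ →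
  adj (G ×ᵍ H) (combine g c) (combine g′ c′) ≡ adj G g g′ ∧ adj H c c′
adj-combine G H g g′ c c′ =
  cong₂ (λ (a , b) (a′ , b′) → adj G a a′ ∧ adj H b b′) (remQuot-combine g c) (remQuot-combine g′ c′)

Dominating : Graph n → Subset n → Set
Dominating {n} H S = ∀ (i : Fin n) → i ∉ S → ∃[ j ] (j ∈ S × adj H j i ≡ true)

independent∧dominating⇒maximal : ∀ (H : Graph n) {S} →
  Independent H S → Dominating H S → MaximalIndependent H S
independent∧dominating⇒maximal H {S} indS domS = indS , maximal
  where
  maximal : ∀ T → Independent H T → S ⊆ T → T ⊆ S
  maximal T indT S⊆T {i} i∈T with i ∈? S
  ... | yes i∈S = i∈S
  ... | no i∉S with domS i i∉S
  ...   | j , j∈S , ji = contradiction (trans (sym ji) (indT j i (S⊆T j∈S) i∈T)) λ ()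

module Neighbourhood (G : Graph n) where

  inClosedNbhd? : ∀ I → Decidable (InClosedNbhd G I)
  inClosedNbhd? I v = v ∈? I ⊎-dec any? λ u → u ∈? I ×-dec adj G u v Bool.≟ true

  N[_] : Subset n → Subset n
  N[ I ] = subsetOf (inClosedNbhd? I)

  ∈N[]⁺ : ∀ {I v} → InClosedNbhd G I v → v ∈ N[ I ]
  ∈N[]⁺ {I} = ∈-subsetOf⁺ (inClosedNbhd? I)

  ∈N[]⁻ : ∀ {I v} → v ∈ N[ I ] → InClosedNbhd G I v
  ∈N[]⁻ {I} = ∈-subsetOf⁻ (inClosedNbhd? I)

  I⊆N[I] : ∀ {I} → I ⊆ N[ I ]
  I⊆N[I] v∈I = ∈N[]⁺ (inj₁ v∈I)

  ∣N[⊥]∣≡0 : ∣ N[ ⊥ ] ∣ ≡ 0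
  ∣N[⊥]∣≡0 = trans (cong ∣_∣ (Empty-unique λ (_ , v∈N[⊥]) → ∉⊥-nbhd (∈N[]⁻ v∈N[⊥]))) (∣⊥∣≡0 n)
    where
    ∉⊥-nbhd : ∀ {v} → ¬ InClosedNbhd G ⊥ v
    ∉⊥-nbhd (inj₁ v∈⊥) = ∉⊥ v∈⊥
    ∉⊥-nbhd (inj₂ (_ , u∈⊥ , _)) = ∉⊥ u∈⊥

  N[I∪J]≡N[I]∪N[J] : ∀ I J → N[ I ∪ J ] ≡ N[ I ] ∪ N[ J ]
  N[I∪J]≡N[I]∪N[J] I J = ⊆-antisym (x∈p∪q⁺ ∘ split ∘ ∈N[]⁻) (∈N[]⁺ ∘ merge ∘ x∈p∪q⁻ _ _)
    where
    split : ∀ {v} → InClosedNbhd G (I ∪ J) v → v ∈ N[ I ] ⊎ v ∈ N[ J ]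
    split (inj₁ v∈I∪J) = Sum.map (∈N[]⁺ ∘ inj₁) (∈N[]⁺ ∘ inj₁) (x∈p∪q⁻ I J v∈I∪J)
    split (inj₂ (u , u∈I∪J , uv)) =
      Sum.map (λ u∈I → ∈N[]⁺ (inj₂ (u , u∈I , uv))) (λ u∈J → ∈N[]⁺ (inj₂ (u , u∈J , uv))) (x∈p∪q⁻ I J u∈I∪J)
    widen : ∀ {K v} → K ⊆ I ∪ J → InClosedNbhd G K v → InClosedNbhd G (I ∪ J) v
    widen K⊆ (inj₁ v∈K) = inj₁ (K⊆ v∈K)
    widen K⊆ (inj₂ (u , u∈K , uv)) = inj₂ (u , K⊆ u∈K , uv)
    merge : ∀ {v} → v ∈ N[ I ] ⊎ v ∈ N[ J ] → InClosedNbhd G (I ∪ J) v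
    merge (inj₁ v∈N[I]) = widen (p⊆p∪q J) (∈N[]⁻ v∈N[I])
    merge (inj₂ v∈N[J]) = widen (q⊆p∪q I J) (∈N[]⁻ v∈N[J])

  ∈N[⁅v⁆]⁻ : ∀ {v w} → w ∈ N[ ⁅ v ⁆ ] → w ≡ v ⊎ adj G v w ≡ true
  ∈N[⁅v⁆]⁻ w∈N[v] with ∈N[]⁻ w∈N[v]
  ... | inj₁ w∈⁅v⁆ = inj₁ (x∈⁅y⁆⇒x≡y _ w∈⁅v⁆)
  ... | inj₂ (u , u∈⁅v⁆ , uw) = inj₂ (subst (λ u → adj G u _ ≡ true) (x∈⁅y⁆⇒x≡y _ u∈⁅v⁆) uw)

  adj⇒∈N[⁅v⁆] : ∀ {v w} → adj G v w ≡ true → w ∈ N[ ⁅ v ⁆ ]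
  adj⇒∈N[⁅v⁆] {v} vw = ∈N[]⁺ (inj₂ (v , x∈⁅x⁆ v , vw))

  independent? : Decidable (Independent G)
  independent? I = all? λ u → all? λ v → u ∈? I →-dec v ∈? I →-dec adj G u v Bool.≟ false

  isolatable? : Decidable (Isolatable G)
  isolatable? x = anySubset? λ I →
    independent? I ×-dec ¬? (inClosedNbhd? I x) ×-dec
    all? (λ y → ¬? (inClosedNbhd? I y) →-dec adj G x y Bool.≟ false)

  NoIsolatedVertexOutside : Subset n → Set
  NoIsolatedVertexOutside I =
    ∀ g → ¬ InClosedNbhd G I g → ∃[ h ] (¬ InClosedNbhd G I h × adj G g h ≡ true)

  noIsolatedVertexOutside : ¬ (∃[ x ] Isolatable G x) → ∀ {I} → Independent G I → NoIsolatedVertexOutside I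
  noIsolatedVertexOutside ¬iso {I} indI g g∉N[I]
    with any? (λ h → ¬? (inClosedNbhd? I h) ×-dec adj G g h Bool.≟ true)
  ... | yes neighbour = neighbour
  ... | no ¬neighbour = contradiction (g , I , indI , g∉N[I] , isolated) ¬iso
    where
    isolated : ∀ y → ¬ InClosedNbhd G I y → adj G g y ≡ false
    isolated y y∉N[I] = ¬-not λ gy → ¬neighbour (y , y∉N[I] , gy)

module Extension (G : Graph n) where

  open Neighbourhood G

  layer : Subset n → Fin 3 → Subset n
  layer I 0F = I ∪ ∁ N[ I ]
  layer I (suc _) = I

  extension : Subset n → Subset (n * 3)
  extension I = stack (layer I)

  I⊆layer : ∀ {I} c → I ⊆ layer I c
  I⊆layer 0F = p⊆p∪q _
  I⊆layer (suc _) = id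

  outside∈layer₀ : ∀ {I g} → ¬ InClosedNbhd G I g → g ∈ layer I 0F
  outside∈layer₀ g∉N[I] = x∈p∪q⁺ (inj₂ (x∉p⇒x∈∁p (g∉N[I] ∘ ∈N[]⁻)))

  ∈-layer⁻ : ∀ {I g} c → g ∈ layer I c → g ∈ I ⊎ (c ≡ 0F × ¬ InClosedNbhd G I g)
  ∈-layer⁻ 0F g∈layer = Sum.map₂ (λ g∈∁N[I] → refl , x∈∁p⇒x∉p g∈∁N[I] ∘ ∈N[]⁺) (x∈p∪q⁻ _ _ g∈layer)
  ∈-layer⁻ (suc _) g∈I = inj₁ g∈I

  ¬adj-outside : ∀ {I g g′} → g ∈ I → ¬ InClosedNbhd G I g′ → adj G g g′ ≡ false
  ¬adj-outside {g = g} g∈I g′∉N[I] = ¬-not λ gg′ → g′∉N[I] (inj₂ (g , g∈I , gg′))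

  extension-independent : ∀ {I} → Independent G I → Independent (G ×ᵍ K 3) (extension I)
  extension-independent {I} indI i j i∈ j∈ =
    ¬adj-layers (∈-layer⁻ (proj₂ (remQuot {n} 3 i)) (∈-stack⁻ (layer I) i i∈))
                (∈-layer⁻ (proj₂ (remQuot {n} 3 j)) (∈-stack⁻ (layer I) j j∈))
    where
    ¬adj-layers : ∀ {g g′ c c′} →
      g ∈ I ⊎ (c ≡ 0F × ¬ InClosedNbhd G I g) → g′ ∈ I ⊎ (c′ ≡ 0F × ¬ InClosedNbhd G I g′) →
      adj G g g′ ∧ adj (K 3) c c′ ≡ false
    ¬adj-layers (inj₁ g∈I) (inj₁ g′∈I) = cong (_∧ _) (indI _ _ g∈I g′∈I)
    ¬adj-layers (inj₁ g∈I) (inj₂ (_ , g′∉N[I])) = cong (_∧ _) (¬adj-outside g∈I g′∉N[I])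
    ¬adj-layers (inj₂ (_ , g∉N[I])) (inj₁ g′∈I) =
      cong (_∧ _) (trans (adj-sym G _ _) (¬adj-outside g′∈I g∉N[I]))
    ¬adj-layers (inj₂ (refl , _)) (inj₂ (refl , _)) = ∧-zeroʳ _

  extension-dominating : ∀ {I} → NoIsolatedVertexOutside I → Dominating (G ×ᵍ K 3) (extension I)
  extension-dominating {I} noIsolated i i∉ =
    subst Dominated (combine-remQuot {n} 3 i) (dominate _ _ (i∉ ∘ subst (_∈ extension I) (combine-remQuot {n} 3 i)))
    where
    Dominated : Fin (n * 3) → Set
    Dominated i = ∃[ j ] (j ∈ extension I × adj (G ×ᵍ K 3) j i ≡ true)
    dominate : ∀ g c → combine g c ∉ extension I → Dominated (combine g c)
    dominate g c gc∉ with inClosedNbhd? I g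
    ... | yes (inj₁ g∈I) = contradiction (∈-stack⁺ (layer I) (I⊆layer c g∈I)) gc∉
    ... | yes (inj₂ (u , u∈I , ug)) =
      combine u (other c) , ∈-stack⁺ (layer I) (I⊆layer (other c) u∈I) ,
      trans (adj-combine G (K 3) u g (other c) c) (cong₂ _∧_ ug (adj-other c))
    dominate g 0F gc∉ | no g∉N[I] = contradiction (∈-stack⁺ (layer I) (outside∈layer₀ g∉N[I])) gc∉
    dominate g (suc c) gc∉ | no g∉N[I] with noIsolated g g∉N[I]
    ... | h , h∉N[I] , gh =
      combine h 0F , ∈-stack⁺ (layer I) (outside∈layer₀ h∉N[I]) ,
      trans (adj-combine G (K 3) h g 0F (suc c)) (cong (_∧ true) (trans (adj-sym G h g) gh))

  extension-maximal : ∀ {I} → Independent G I → NoIsolatedVertexOutside I →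
    MaximalIndependent (G ×ᵍ K 3) (extension I)
  extension-maximal indI noIsolated =
    independent∧dominating⇒maximal (G ×ᵍ K 3) (extension-independent indI) (extension-dominating noIsolated)

  ∣extension∣+∣N[I]∣≡3*∣I∣+n : ∀ I → ∣ extension I ∣ + ∣ N[ I ] ∣ ≡ 3 * ∣ I ∣ + n
  ∣extension∣+∣N[I]∣≡3*∣I∣+n I = begin
    ∣ extension I ∣ + ∣N[I]∣                 ≡⟨ cong (_+ ∣N[I]∣) (∣stack∣ (layer I)) ⟩
    ∣ I ∪ ∁ N[ I ] ∣ + ∣I∣ + ∣I∣ + ∣N[I]∣     ≡⟨ cong (λ k → k + ∣I∣ + ∣I∣ + ∣N[I]∣) ∣I∪∁N[I]∣ ⟩
    ∣I∣ + ∣∁N[I]∣ + ∣I∣ + ∣I∣ + ∣N[I]∣        ≡⟨ rearrange ∣I∣ ∣∁N[I]∣ ∣N[I]∣ ⟩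
    3 * ∣I∣ + (∣∁N[I]∣ + ∣N[I]∣)             ≡⟨ cong (3 * ∣I∣ +_) (∣∁p∣+∣p∣≡n N[ I ]) ⟩
    3 * ∣I∣ + n                             ∎
    where
    open ≡-Reasoning
    ∣I∣ = ∣ I ∣
    ∣N[I]∣ = ∣ N[ I ] ∣
    ∣∁N[I]∣ = ∣ ∁ N[ I ] ∣
    ∣I∪∁N[I]∣ : ∣ I ∪ ∁ N[ I ] ∣ ≡ ∣I∣ + ∣∁N[I]∣
    ∣I∪∁N[I]∣ = ∣p∪q∣≡∣p∣+∣q∣ (x∈p⇒x∉∁p ∘ I⊆N[I])
    rearrange : ∀ a b c → a + b + a + a + c ≡ 3 * a + (b + c)
    rearrange = solve-∀

triangle≅K3 : ∀ (G : Graph n) {x y z} →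
  adj G x y ≡ true → adj G x z ≡ true → adj G y z ≡ true → Connected G →
  (∀ {u w} → u ≡ x ⊎ u ≡ y ⊎ u ≡ z → adj G u w ≡ true → w ≡ x ⊎ w ≡ y ⊎ w ≡ z) →
  G ≅ K 3
triangle≅K3 {n} G {x} {y} {z} xy xz yz connected closed =
  mk↔ₛ′ position corner position∘corner corner∘position , adj-position
  where
  corner : Fin 3 → Fin n
  corner 0F = x
  corner 1F = y
  corner 2F = z

  inTriangle : ∀ {w} → w ≡ x ⊎ w ≡ y ⊎ w ≡ z → ∃[ i ] corner i ≡ w
  inTriangle (inj₁ refl) = 0F , refl
  inTriangle (inj₂ (inj₁ refl)) = 1F , refl
  inTriangle (inj₂ (inj₂ refl)) = 2F , refl

  reach : ∀ {u w} → Reachable G u w → u ≡ x ⊎ u ≡ y ⊎ u ≡ z → w ≡ x ⊎ w ≡ y ⊎ w ≡ z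
  reach here u∈ = u∈
  reach (step uv v↝w) u∈ = reach v↝w (closed u∈ uv)

  located : ∀ w → ∃[ i ] corner i ≡ w
  located w = inTriangle (reach (connected x w) (inj₁ refl))

  position : Fin n → Fin 3
  position w = proj₁ (located w)

  corner∘position : ∀ w → corner (position w) ≡ w
  corner∘position w = proj₂ (located w)

  corner-injective : ∀ i j → corner i ≡ corner j → i ≡ j
  corner-injective 0F 0F _ = refl
  corner-injective 1F 1F _ = refl
  corner-injective 2F 2F _ = refl
  corner-injective 0F 1F x≡y = contradiction x≡y (adjacent⇒≢ G xy)
  corner-injective 0F 2F x≡z = contradiction x≡z (adjacent⇒≢ G xz)
  corner-injective 1F 2F y≡z = contradiction y≡z (adjacent⇒≢ G yz)
  corner-injective 1F 0F y≡x = contradiction (sym y≡x) (adjacent⇒≢ G xy)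
  corner-injective 2F 0F z≡x = contradiction (sym z≡x) (adjacent⇒≢ G xz)
  corner-injective 2F 1F z≡y = contradiction (sym z≡y) (adjacent⇒≢ G yz)

  position∘corner : ∀ i → position (corner i) ≡ i
  position∘corner i = corner-injective _ _ (corner∘position (corner i))

  adj-corner : ∀ i j → adj G (corner i) (corner j) ≡ adj (K 3) i j
  adj-corner 0F 0F = irrefl G x
  adj-corner 1F 1F = irrefl G y
  adj-corner 2F 2F = irrefl G z
  adj-corner 0F 1F = xy
  adj-corner 0F 2F = xz
  adj-corner 1F 2F = yz
  adj-corner 1F 0F = trans (adj-sym G y x) xy
  adj-corner 2F 0F = trans (adj-sym G z x) xz
  adj-corner 2F 1F = trans (adj-sym G z y) yz

  adj-position : ∀ u v → adj (K 3) (position u) (position v) ≡ adj G u v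
  adj-position u v = trans (sym (adj-corner (position u) (position v)))
    (cong₂ (adj G) (corner∘position u) (corner∘position v))

module WithoutIsolatableVertex (G : Graph n) (wellCovered : WellCovered (G ×ᵍ K 3))
  (¬isolatable : ¬ (∃[ x ] Isolatable G x)) where

  open Neighbourhood G
  open Extension G

  ∣N[I]∣≡3*∣I∣ : ∀ {I} → Independent G I → ∣ N[ I ] ∣ ≡ 3 * ∣ I ∣
  ∣N[I]∣≡3*∣I∣ {I} indI = +-cancelˡ-≡ n _ _ (begin
    n + ∣ N[ I ] ∣                  ≡⟨ cong (_+ ∣ N[ I ] ∣) (trans (sym ∣extension⊥∣≡n) sameSize) ⟩
    ∣ extension I ∣ + ∣ N[ I ] ∣    ≡⟨ ∣extension∣+∣N[I]∣≡3*∣I∣+n I ⟩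
    3 * ∣ I ∣ + n                   ≡⟨ +-comm (3 * ∣ I ∣) n ⟩
    n + 3 * ∣ I ∣                   ∎)
    where
    open ≡-Reasoning
    ⊥-independent : Independent G ⊥
    ⊥-independent _ _ u∈⊥ _ = contradiction u∈⊥ ∉⊥
    maximal : ∀ {J} → Independent G J → MaximalIndependent (G ×ᵍ K 3) (extension J)
    maximal indJ = extension-maximal indJ (noIsolatedVertexOutside ¬isolatable indJ)
    sameSize : ∣ extension ⊥ ∣ ≡ ∣ extension I ∣
    sameSize = wellCovered _ _ (maximal ⊥-independent) (maximal indI)
    ∣extension⊥∣≡n : ∣ extension ⊥ ∣ ≡ n
    ∣extension⊥∣≡n = begin
      ∣ extension ⊥ ∣                  ≡⟨ +-identityʳ _ ⟨
      ∣ extension ⊥ ∣ + 0              ≡⟨ cong (∣ extension ⊥ ∣ +_) ∣N[⊥]∣≡0 ⟨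
      ∣ extension ⊥ ∣ + ∣ N[ ⊥ ] ∣     ≡⟨ ∣extension∣+∣N[I]∣≡3*∣I∣+n ⊥ ⟩
      3 * ∣ ⊥ {n = n} ∣ + n            ≡⟨ cong (λ k → 3 * k + n) (∣⊥∣≡0 n) ⟩
      n                                ∎

  ∣N[⁅x⁆]∣≡3 : ∀ x → ∣ N[ ⁅ x ⁆ ] ∣ ≡ 3
  ∣N[⁅x⁆]∣≡3 x = trans (∣N[I]∣≡3*∣I∣ (⁅x⁆-independent G x)) (cong (3 *_) (∣⁅x⁆∣≡1 x))

  two-neighbours : ∀ x → ∃₂ λ y z → y ≢ z × adj G x y ≡ true × adj G x z ≡ true
  two-neighbours x =
    let y , z , y∈N[x] , z∈N[x] , y≢x , z≢x , y≢z =
          ∣p∣≡3⇒two-others {p = N[ ⁅ x ⁆ ]} (∣N[⁅x⁆]∣≡3 x) (I⊆N[I] (x∈⁅x⁆ x))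
    in y , z , y≢z , neighbour y∈N[x] y≢x , neighbour z∈N[x] z≢x
    where
    neighbour : ∀ {w} → w ∈ N[ ⁅ x ⁆ ] → w ≢ x → adj G x w ≡ true
    neighbour w∈N[x] w≢x = Sum.[ flip contradiction w≢x , id ] (∈N[⁅v⁆]⁻ w∈N[x])

  triangle-closed : ∀ {a b c w} → adj G a b ≡ true → adj G a c ≡ true → adj G b c ≡ true →
    adj G a w ≡ true → w ≡ b ⊎ w ≡ c
  triangle-closed {a} ab ac bc aw =
    Sum.[ flip contradiction (adjacent⇒≢ G aw) ∘ sym , id ]
      (∣p∣≡3⇒∈-three {p = N[ ⁅ a ⁆ ]} (∣N[⁅x⁆]∣≡3 a) (I⊆N[I] (x∈⁅x⁆ a)) (adj⇒∈N[⁅v⁆] ab) (adj⇒∈N[⁅v⁆] ac)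
        (adjacent⇒≢ G ab) (adjacent⇒≢ G ac) (adjacent⇒≢ G bc) (adj⇒∈N[⁅v⁆] aw))

  common-neighbour⇒adjacent : ∀ {x y z} → y ≢ z → adj G x y ≡ true → adj G x z ≡ true → adj G y z ≡ true
  common-neighbour⇒adjacent {x} {y} {z} y≢z xy xz = ¬-not λ yz →
    0≢1+n (trans (sym (∣N[y]∩N[z]∣≡0 yz)) (x∈p⇒∣p∣≡1+∣p-x∣ x∈N[y]∩N[z]))
    where
    open ≡-Reasoning
    N[y] = N[ ⁅ y ⁆ ]
    N[z] = N[ ⁅ z ⁆ ]
    x∈N[y]∩N[z] : x ∈ N[y] ∩ N[z]
    x∈N[y]∩N[z] = x∈p∩q⁺ (adj⇒∈N[⁅v⁆] (trans (adj-sym G y x) xy) , adj⇒∈N[⁅v⁆] (trans (adj-sym G z x) xz))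
    ∣⁅y⁆∪⁅z⁆∣≡2 : ∣ ⁅ y ⁆ ∪ ⁅ z ⁆ ∣ ≡ 2
    ∣⁅y⁆∪⁅z⁆∣≡2 = trans (∣p∪q∣≡∣p∣+∣q∣ λ u∈⁅y⁆ → x≢y⇒x∉⁅y⁆ (y≢z ∘ trans (sym (x∈⁅y⁆⇒x≡y y u∈⁅y⁆))))
                        (cong₂ _+_ (∣⁅x⁆∣≡1 y) (∣⁅x⁆∣≡1 z))
    ∣N[y]∩N[z]∣≡0 : adj G y z ≡ false → ∣ N[y] ∩ N[z] ∣ ≡ 0
    ∣N[y]∩N[z]∣≡0 yz = +-cancelˡ-≡ 6 _ _ (begin
      6 + ∣ N[y] ∩ N[z] ∣                     ≡⟨ cong (λ k → 3 * k + ∣ N[y] ∩ N[z] ∣) ∣⁅y⁆∪⁅z⁆∣≡2 ⟨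
      3 * ∣ ⁅ y ⁆ ∪ ⁅ z ⁆ ∣ + ∣ N[y] ∩ N[z] ∣  ≡⟨ cong (_+ ∣ N[y] ∩ N[z] ∣) (∣N[I]∣≡3*∣I∣ (⁅x⁆∪⁅y⁆-independent G yz)) ⟨
      ∣ N[ ⁅ y ⁆ ∪ ⁅ z ⁆ ] ∣ + ∣ N[y] ∩ N[z] ∣  ≡⟨ cong (λ p → ∣ p ∣ + ∣ N[y] ∩ N[z] ∣) (N[I∪J]≡N[I]∪N[J] _ _) ⟩
      ∣ N[y] ∪ N[z] ∣ + ∣ N[y] ∩ N[z] ∣       ≡⟨ ∣p∪q∣+∣p∩q∣≡∣p∣+∣q∣ N[y] N[z] ⟩
      ∣ N[y] ∣ + ∣ N[z] ∣                     ≡⟨ cong₂ _+_ (∣N[⁅x⁆]∣≡3 y) (∣N[⁅x⁆]∣≡3 z) ⟩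
      6                                      ≡⟨ +-identityʳ 6 ⟨
      6 + 0                                  ∎)

  G≅K3 : Connected G → Fin n → G ≅ K 3
  G≅K3 connected x =
    let y , z , y≢z , xy , xz = two-neighbours x
        yz = common-neighbour⇒adjacent y≢z xy xz
    in triangle≅K3 G xy xz yz connected (closed xy xz yz)
    where
    closed : ∀ {y z u w} → adj G x y ≡ true → adj G x z ≡ true → adj G y z ≡ true →
      u ≡ x ⊎ u ≡ y ⊎ u ≡ z → adj G u w ≡ true → w ≡ x ⊎ w ≡ y ⊎ w ≡ z
    closed xy xz yz (inj₁ refl) uw = inj₂ (triangle-closed xy xz yz uw)
    closed {y} xy xz yz (inj₂ (inj₁ refl)) uw =
      Sum.map₂ inj₂ (triangle-closed (trans (adj-sym G y x) xy) yz xz uw)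
    closed {y} {z} xy xz yz (inj₂ (inj₂ refl)) uw =
      Sum.map₂ inj₁ (triangle-closed (trans (adj-sym G z x) xz) (trans (adj-sym G z y) yz) xy uw)

corollary4p3 : ∀ {n : ℕ} (G : Graph n) → Nontrivial G → Connected G →
    WellCovered (G ×ᵍ K 3) → (G ≅ K 3) ⊎ (∃[ x ] Isolatable G x)
corollary4p3 {zero} G () _ _
corollary4p3 {suc _} G _ connected wellCovered with any? (Neighbourhood.isolatable? G)
... | yes isolatable = inj₂ isolatable
... | no ¬isolatable = inj₁ (WithoutIsolatableVertex.G≅K3 G wellCovered ¬isolatable connected zero)
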